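{- Let $G$ be a strong digraph, and let $C$ be a cycle of $G$ (not necessarily directed). Then either there is an edge $e$ of $C$ such that $G\setminus e$ is strong, or there is a partition $(A,B)$ of $V(G)$ such that there is exactly one edge of $G$ from $A$ to $B$ and exactly one edge of $G$ from $B$ to $A$.
   Context: Digraphs are finite, with no loops, no parallel edges and no directed cycles of length two. A digraph is strong if it is strongly connected. A cycle of a digraph $G$ is a subdigraph whose underlying undirected graph is a cycle; it need not be a directed cycle. -}

module Defs where

open import Data.Nat using (ℕ; suc)
open import Data.Fin using (Fin; zero; suc; inject₁; fromℕ)
open import Data.Bool using (Bool; true; false; T)
open import Data.Product using (Σ; ∃; _×_; _,_)
open import Data.Sum using (_⊎_)
open import Relation.Nullary using (¬_)
open import Relation.Binary.PropositionalEquality using (_≡_)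
open import Function.Definitions using (Injective)

-- No loops, no directed cycles of length two; parallel edges are
-- impossible by construction (an edge is determined by its ordered ends).
record Digraph : Set where
  field
    n        : ℕ
    adj      : Fin n → Fin n → Bool
    loopless : ∀ v → adj v v ≡ false
    no2cycle : ∀ u v → T (adj u v) → adj v u ≡ false

open Digraph public

Edge : (G : Digraph) → Fin (n G) → Fin (n G) → Set
Edge G u v = T (adj G u v)

data Reach {m : ℕ} (R : Fin m → Fin m → Set) : Fin m → Fin m → Set where
  here : ∀ {u} → Reach R u u
  step : ∀ {u v w} → R u v → Reach R v w → Reach R u w

StrongRel : {m : ℕ} → (Fin m → Fin m → Set) → Set
StrongRel {m} R = ∀ (u v : Fin m) → Reach R u v

Strong : Digraph → Set
Strong G = StrongRel (Edge G)

DelEdge : (G : Digraph) → Fin (n G) → Fin (n G) → Fin (n G) → Fin (n G) → Set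
DelEdge G a b x y = Edge G x y × ¬ (x ≡ a × y ≡ b)

Adjacent : (G : Digraph) → Fin (n G) → Fin (n G) → Set
Adjacent G u v = Edge G u v ⊎ Edge G v u

-- A cycle of G (not necessarily directed): distinct vertices
-- c 0, c 1, …, c (k+2)  (k+3 ≥ 3 of them) with consecutive ones, and also
-- the last and the first, adjacent in the underlying graph.
record Cycle (G : Digraph) : Set where
  field
    k        : ℕ
    vert     : Fin (suc (suc (suc k))) → Fin (n G)
    distinct : Injective _≡_ _≡_ vert
    consec   : ∀ (i : Fin (suc (suc k))) → Adjacent G (vert (inject₁ i)) (vert (suc i))
    closing  : Adjacent G (vert (fromℕ (suc (suc k)))) (vert zero)

open Cycle public

SamePair : {m : ℕ} → Fin m → Fin m → Fin m → Fin m → Set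
SamePair x y u v = (x ≡ u × y ≡ v) ⊎ (x ≡ v × y ≡ u)

CycleEdge : (G : Digraph) → Cycle G → Fin (n G) → Fin (n G) → Set
CycleEdge G C x y =
  Edge G x y ×
  ((Σ (Fin (suc (suc (k C)))) λ i → SamePair x y (vert C (inject₁ i)) (vert C (suc i)))
   ⊎ SamePair x y (vert C (fromℕ (suc (suc (k C))))) (vert C zero))

ExactlyOneEdge : (G : Digraph) → (Fin (n G) → Bool) → (Fin (n G) → Bool) → Set
ExactlyOneEdge G A B =
  Σ (Fin (n G)) λ a → Σ (Fin (n G)) λ b →
    (T (A a) × T (B b) × Edge G a b) ×
    (∀ a' b' → T (A a') → T (B b') → Edge G a' b' → a' ≡ a × b' ≡ b)

IsPartition : (G : Digraph) → (Fin (n G) → Bool) → (Fin (n G) → Bool) → Set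
IsPartition G A B =
  (∀ v → (T (A v) × ¬ T (B v)) ⊎ (¬ T (A v) × T (B v))) ×
  (∃ λ a → T (A a)) × (∃ λ b → T (B b))

{-# OPTIONS --safe #-}

-- For a cycle edge uv let S be the set of vertices reachable from u in G ∖ uv.  If v ∈ S then
-- G ∖ uv is strong; otherwise uv is the only edge leaving S, so C re-enters S through another
-- edge xy.  Let Q ⊇ S be the set of vertices reaching y in G ∖ xy.  If x ∈ Q then G ∖ xy is
-- strong, and if Q = S then uv is the only edge leaving S and xy the only one entering it.
-- Otherwise C leaves Q through an edge ab ≠ xy whose tail lies outside S, and the set of
-- vertices reachable from a in G ∖ ab strictly contains S.  Repeating with ab, S keeps
-- growing, so one of the two conclusions is eventually reached.

module Submission where

open import Defs
open import Data.Nat using (ℕ; zero; suc)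
open import Data.Fin using (Fin; zero; suc; inject₁; fromℕ; _≟_)
open import Data.Fin.Properties using (any?; suc-injective; inject₁-injective; fromℕ≢inject₁)
open import Data.Fin.Subset using (Subset; _∈_; _∉_; _⊂_; _⊃_; _∪_; ⁅_⁆)
open import Data.Fin.Subset.Properties using (_∈?_; p⊆p∪q; x∈p∪q⁺; x∈p∪q⁻; x∈⁅x⁆; x∈⁅y⁆⇒x≡y)
open import Data.Fin.Subset.Induction using (⊃-wellFounded)
open import Data.Bool using (Bool; T)
open import Data.Bool.Properties using (T-≡) renaming (_≟_ to _≟ᵇ_)
open import Data.Vec using (tabulate)
open import Data.Vec.Properties using (lookup∘tabulate; []=⇒lookup; lookup⇒[]=)
open import Data.Product using (Σ; ∃; ∃₂; _×_; _,_; proj₁; map₁)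
open import Data.Sum using (_⊎_; inj₁; inj₂; [_,_])
open import Data.Empty using (⊥-elim)
open import Function using (_∘_; id; Equivalence)
open import Induction.WellFounded using (Acc; acc)
open import Relation.Binary.Definitions using (Decidable)
open import Relation.Nullary using (¬_; Dec; yes; no; ¬?; _×-dec_; contradiction)
open import Relation.Nullary.Decidable using (⌊_⌋; T?; toWitness; fromWitness; map′; decidable-stable)
import Relation.Unary as U
open import Relation.Binary.PropositionalEquality using (_≡_; _≢_; refl; sym; trans; subst; ≢-sym)

private
  variable
    m : ℕ
    R R′ : Fin m → Fin m → Set
    X : Fin m → Set
    a b p q s t u v x y z z′ : Fin m
    i j : Fin m

infixr 5 _◅◅_

_◅◅_ : Reach R s t → Reach R t u → Reach R s u
here ◅◅ r′ = r′
step e r ◅◅ r′ = step e (r ◅◅ r′)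

mapReach : (∀ {x y} → R x y → R′ x y) → Reach R s t → Reach R′ s t
mapReach f here = here
mapReach f (step e r) = step (f e) (mapReach f r)

Without : (Fin m → Fin m → Set) → Fin m → Fin m → Fin m → Fin m → Set
Without R a b x y = R x y × ¬ (x ≡ a × y ≡ b)

reroute : Reach (Without R a b) a b → Reach R s t → Reach (Without R a b) s t
reroute a⇝b here = here
reroute {a = a} {b = b} a⇝b (step {u = p} {v = q} e r) with p ≟ a ×-dec q ≟ b
... | yes (refl , refl) = a⇝b ◅◅ reroute a⇝b r
... | no pq≢ab = step (e , pq≢ab) (reroute a⇝b r)

strong-without : StrongRel R → Reach (Without R a b) a b → StrongRel (Without R a b)
strong-without strong a⇝b s t = reroute a⇝b (strong s t)

prefix-to-tail : Reach R s a → Reach (Without R a b) s a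
prefix-to-tail here = here
prefix-to-tail {a = a} {b = b} (step {u = p} {v = q} e r) with p ≟ a ×-dec q ≟ b
... | yes (refl , _) = here
... | no pq≢ab = step (e , pq≢ab) (prefix-to-tail r)

avoid-or-suffix : Reach R s t → Reach (Without R a b) s t ⊎ Reach (Without R a b) b t
avoid-or-suffix here = inj₁ here
avoid-or-suffix {a = a} {b = b} (step {u = p} {v = q} e r)
  with avoid-or-suffix {a = a} {b = b} r | p ≟ a ×-dec q ≟ b
... | inj₂ b⇝t | _ = inj₂ b⇝t
... | inj₁ q⇝t | yes (_ , refl) = inj₂ q⇝t
... | inj₁ q⇝t | no pq≢ab = inj₁ (step (e , pq≢ab) q⇝t)

suffix-from-head : Reach R b t → Reach (Without R a b) b t
suffix-from-head {a = a} r = [ id , id ] (avoid-or-suffix {a = a} r)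

avoid-unreachable-tail : ¬ Reach R s a → Reach R s z → Reach R z t → Reach (Without R a b) z t
avoid-unreachable-tail ¬s⇝a s⇝z here = here
avoid-unreachable-tail {R = R} {s = s} ¬s⇝a s⇝z (step e r) =
  step (e , λ (z≡a , _) → ¬s⇝a (subst (Reach R s) z≡a s⇝z))
       (avoid-unreachable-tail ¬s⇝a (s⇝z ◅◅ step e here) r)

avoid-nonreaching-head : ¬ Reach R b t → Reach R s t → Reach (Without R a b) s t
avoid-nonreaching-head ¬b⇝t here = here
avoid-nonreaching-head {R = R} {t = t} ¬b⇝t (step e r) =
  step (e , λ (_ , q≡b) → ¬b⇝t (subst (λ q → Reach R q t) q≡b r))
       (avoid-nonreaching-head ¬b⇝t r)

leaves-only-by : Reach (Without R a b) s p → ¬ Reach (Without R a b) s q → R p q → p ≡ a × q ≡ b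
leaves-only-by s⇝p ¬s⇝q e =
  decidable-stable (_ ≟ _ ×-dec _ ≟ _) λ pq≢ab → ¬s⇝q (s⇝p ◅◅ step (e , pq≢ab) here)

enters-only-by : ¬ Reach (Without R a b) p t → Reach (Without R a b) q t → R p q → p ≡ a × q ≡ b
enters-only-by ¬p⇝t q⇝t e =
  decidable-stable (_ ≟ _ ×-dec _ ≟ _) λ pq≢ab → ¬p⇝t (step (e , pq≢ab) q⇝t)

module _ {R : Fin m → Fin m → Set} (R? : Decidable R) where
  private
    Escape : Subset m → Set
    Escape X = ∃₂ λ x y → x ∈ X × R x y × y ∉ X

    escape? : (X : Subset m) → Dec (Escape X)
    escape? X = any? λ x → any? λ y → x ∈? X ×-dec R? x y ×-dec ¬? (y ∈? X)

    closed : {X : Subset m} → ¬ Escape X → x ∈ X → Reach R x t → t ∈ X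
    closed no-escape x∈X here = x∈X
    closed {X = X} no-escape x∈X (step {v = y} e r) with y ∈? X
    ... | yes y∈X = closed no-escape y∈X r
    ... | no y∉X = contradiction (_ , y , x∈X , e , y∉X) no-escape

    explore : (X : Subset m) → Acc _⊃_ X → (∀ {t} → t ∈ X → Reach R s t) → s ∈ X →
              ∀ t → Dec (Reach R s t)
    explore X (acc larger) sound s∈X t with escape? X
    ... | no no-escape = map′ sound (closed no-escape s∈X) (t ∈? X)
    ... | yes (x , y , x∈X , e , y∉X) =
      explore (X ∪ ⁅ y ⁆) (larger (p⊆p∪q ⁅ y ⁆ , y , x∈p∪q⁺ (inj₂ (x∈⁅x⁆ y)) , y∉X))
              sound′ (p⊆p∪q ⁅ y ⁆ s∈X) t
      where
      sound′ : ∀ {t} → t ∈ X ∪ ⁅ y ⁆ → Reach R _ t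
      sound′ t∈ with x∈p∪q⁻ X ⁅ y ⁆ t∈
      ... | inj₁ t∈X = sound t∈X
      ... | inj₂ t∈⁅y⁆ rewrite x∈⁅y⁆⇒x≡y y t∈⁅y⁆ = sound x∈X ◅◅ step e here

  reach? : Decidable (Reach R)
  reach? s = explore ⁅ s ⁆ (⊃-wellFounded _) sound (x∈⁅x⁆ s)
    where
    sound : ∀ {t} → t ∈ ⁅ s ⁆ → Reach R s t
    sound t∈ rewrite x∈⁅y⁆⇒x≡y s t∈ = here

∈-tabulate⁺ : (X? : U.Decidable X) → X x → x ∈ tabulate (λ z → ⌊ X? z ⌋)
∈-tabulate⁺ {x = x} X? px =
  lookup⇒[]= x _ (trans (lookup∘tabulate _ x) (Equivalence.to T-≡ (fromWitness px)))

∈-tabulate⁻ : (X? : U.Decidable X) → x ∈ tabulate (λ z → ⌊ X? z ⌋) → X x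
∈-tabulate⁻ {x = x} X? x∈ =
  toWitness (Equivalence.from T-≡ (trans (sym (lookup∘tabulate _ x)) ([]=⇒lookup x∈)))

⊂-tabulate : {Y : Fin m → Set} (X? : U.Decidable X) (Y? : U.Decidable Y) →
             (∀ {z} → X z → Y z) → Y a → ¬ X a →
             tabulate (λ z → ⌊ X? z ⌋) ⊂ tabulate (λ z → ⌊ Y? z ⌋)
⊂-tabulate X? Y? X⊆Y ya ¬xa =
  ∈-tabulate⁺ Y? ∘ X⊆Y ∘ ∈-tabulate⁻ X? , _ , ∈-tabulate⁺ Y? ya , ¬xa ∘ ∈-tabulate⁻ X?

ChangesAt : (Fin (suc m) → Bool) → Fin m → Set
ChangesAt f i = f (inject₁ i) ≢ f (suc i)

change-between-ends : (f : Fin (suc m) → Bool) → f zero ≢ f (fromℕ m) → ∃ (ChangesAt f)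
change-between-ends {zero} f ends-differ = contradiction refl ends-differ
change-between-ends {suc m} f ends-differ with f zero ≟ᵇ f (suc zero)
... | no first-differs = zero , first-differs
... | yes first-agrees =
  let (i , change) = change-between-ends (f ∘ suc) (ends-differ ∘ trans first-agrees)
  in suc i , change

another-change : (f : Fin (suc m) → Bool) → f zero ≡ f (fromℕ m) → ChangesAt f i →
                 ∃ λ j → j ≢ i × ChangesAt f j
another-change {suc m} {zero} f ends-agree change =
  let (j , change′) = change-between-ends (f ∘ suc) (change ∘ trans ends-agree ∘ sym)
  in suc j , (λ ()) , change′
another-change {suc m} {suc i} f ends-agree change with f zero ≟ᵇ f (suc zero)
... | no first-differs = zero , (λ ()) , first-differs
... | yes first-agrees =
  let (j , j≢i , change′) = another-change (f ∘ suc) (trans (sym first-agrees) ends-agree) change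
  in suc j , j≢i ∘ suc-injective , change′

SamePair-sym : SamePair p q a b → SamePair a b p q
SamePair-sym (inj₁ (refl , refl)) = inj₁ (refl , refl)
SamePair-sym (inj₂ (refl , refl)) = inj₂ (refl , refl)

bichromatic-SamePair : (c : Fin m → Bool) → SamePair p q a b → c a ≢ c b → c p ≢ c q
bichromatic-SamePair c (inj₁ (refl , refl)) = id
bichromatic-SamePair c (inj₂ (refl , refl)) = ≢-sym

consecutive-injective : SamePair (inject₁ i) (suc i) (inject₁ j) (suc j) → i ≡ j
consecutive-injective (inj₁ (same , _)) = inject₁-injective same
consecutive-injective (inj₂ (crossed₁ , crossed₂)) = ⊥-elim (uncrossed crossed₁ crossed₂)
  where
  uncrossed : ∀ {m} {i j : Fin m} → inject₁ i ≡ suc j → suc i ≢ inject₁ j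
  uncrossed {i = zero} ()
  uncrossed {i = suc i} {zero} _ ()
  uncrossed {i = suc i} {suc j} e₁ e₂ = uncrossed (suc-injective e₁) (suc-injective e₂)

consecutive≢closing : {i : Fin (suc (suc m))} →
                      ¬ SamePair (inject₁ i) (suc i) (fromℕ (suc (suc m))) zero
consecutive≢closing (inj₁ (at-last , _)) = fromℕ≢inject₁ (sym at-last)
consecutive≢closing {i = zero} (inj₂ (_ , ()))
consecutive≢closing {i = suc _} (inj₂ (() , _))

module _ {G : Digraph} (C : Cycle G) where
  private
    last : Fin (suc (suc (suc (k C))))
    last = fromℕ (suc (suc (k C)))

  consecutive-edge : (i : Fin (suc (suc (k C)))) →
    ∃₂ λ p q → CycleEdge G C p q × SamePair p q (vert C (inject₁ i)) (vert C (suc i))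
  consecutive-edge i with consec C i
  ... | inj₁ e = _ , _ , (e , inj₁ (i , inj₁ (refl , refl))) , inj₁ (refl , refl)
  ... | inj₂ e = _ , _ , (e , inj₁ (i , inj₂ (refl , refl))) , inj₂ (refl , refl)

  closing-edge : ∃₂ λ p q → CycleEdge G C p q × SamePair p q (vert C last) (vert C zero)
  closing-edge with closing C
  ... | inj₁ e = _ , _ , (e , inj₂ (inj₁ (refl , refl))) , inj₁ (refl , refl)
  ... | inj₂ e = _ , _ , (e , inj₂ (inj₂ (refl , refl))) , inj₂ (refl , refl)

  same-pair-of-vertices : ∀ {i j i′ j′} →
    SamePair p q (vert C i) (vert C j) → SamePair x y (vert C i′) (vert C j′) →
    p ≡ x × q ≡ y → SamePair i j i′ j′
  same-pair-of-vertices (inj₁ (refl , refl)) (inj₁ (refl , refl)) (e₁ , e₂) =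
    inj₁ (distinct C e₁ , distinct C e₂)
  same-pair-of-vertices (inj₁ (refl , refl)) (inj₂ (refl , refl)) (e₁ , e₂) =
    inj₂ (distinct C e₁ , distinct C e₂)
  same-pair-of-vertices (inj₂ (refl , refl)) (inj₁ (refl , refl)) (e₁ , e₂) =
    inj₂ (distinct C e₂ , distinct C e₁)
  same-pair-of-vertices (inj₂ (refl , refl)) (inj₂ (refl , refl)) (e₁ , e₂) =
    inj₁ (distinct C e₂ , distinct C e₁)

  -- Going once around C the colour changes an even number of times, so never exactly once.
  other-bichromatic-edge : (c : Fin (n G) → Bool) → CycleEdge G C x y → c x ≢ c y →
    ∃₂ λ p q → CycleEdge G C p q × ¬ (p ≡ x × q ≡ y) × c p ≢ c q
  other-bichromatic-edge c (_ , inj₂ xy∼last) cx≢cy =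
    let (i , change) = change-between-ends (c ∘ vert C)
                         (≢-sym (bichromatic-SamePair c (SamePair-sym xy∼last) cx≢cy))
        (p , q , pq , pq∼i) = consecutive-edge i
    in p , q , pq , consecutive≢closing ∘ same-pair-of-vertices pq∼i xy∼last
     , bichromatic-SamePair c pq∼i change
  other-bichromatic-edge c (_ , inj₁ (i , xy∼i)) cx≢cy with c (vert C zero) ≟ᵇ c (vert C last)
  ... | no ends-differ =
    let (p , q , pq , pq∼last) = closing-edge
    in p , q , pq , consecutive≢closing ∘ SamePair-sym ∘ same-pair-of-vertices pq∼last xy∼i
     , bichromatic-SamePair c pq∼last (≢-sym ends-differ)
  ... | yes ends-agree =
    let (j , j≢i , change) = another-change (c ∘ vert C) ends-agree
                               (bichromatic-SamePair c (SamePair-sym xy∼i) cx≢cy)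
        (p , q , pq , pq∼j) = consecutive-edge j
    in p , q , pq , j≢i ∘ consecutive-injective ∘ same-pair-of-vertices pq∼j xy∼i
     , bichromatic-SamePair c pq∼j change

Separates : (Fin m → Set) → Fin m → Fin m → Set
Separates X p q = (X p × ¬ X q) ⊎ (¬ X p × X q)

separates⇒≢ : (X? : U.Decidable X) → Separates X p q → ⌊ X? p ⌋ ≢ ⌊ X? q ⌋
separates⇒≢ {q = q} X? (inj₁ (xp , ¬xq)) eq =
  ¬xq (toWitness {a? = X? q} (subst T eq (fromWitness xp)))
separates⇒≢ {p = p} X? (inj₂ (¬xp , xq)) eq =
  ¬xp (toWitness {a? = X? p} (subst T (sym eq) (fromWitness xq)))

≢⇒separates : (X? : U.Decidable X) → ⌊ X? p ⌋ ≢ ⌊ X? q ⌋ → Separates X p q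
≢⇒separates {p = p} {q = q} X? ne with X? p | X? q
... | yes xp | no ¬xq = inj₁ (xp , ¬xq)
... | no ¬xp | yes xq = inj₂ (¬xp , xq)
... | yes _ | yes _ = contradiction refl ne
... | no _ | no _ = contradiction refl ne

other-separating-edge : {G : Digraph} {C : Cycle G} {X : Fin (n G) → Set} {x y : Fin (n G)} →
  (X? : U.Decidable X) →
  CycleEdge G C x y → Separates X x y →
  ∃₂ λ p q → CycleEdge G C p q × ¬ (p ≡ x × q ≡ y) × Separates X p q
other-separating-edge {C = C} X? xy sep =
  let (p , q , pq , pq≢xy , bichromatic) =
        other-bichromatic-edge C (λ z → ⌊ X? z ⌋) xy (separates⇒≢ X? sep)
  in p , q , pq , pq≢xy , ≢⇒separates X? bichromatic

complement-partition : {G : Digraph} {X : Fin (n G) → Set} {a b : Fin (n G)} →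
  (X? : U.Decidable X) → X a → ¬ X b →
  IsPartition G (λ z → ⌊ X? z ⌋) (λ z → ⌊ ¬? (X? z) ⌋)
complement-partition X? xa ¬xb = side , (_ , fromWitness xa) , (_ , fromWitness ¬xb)
  where
  side : ∀ z → (T ⌊ X? z ⌋ × ¬ T ⌊ ¬? (X? z) ⌋) ⊎ (¬ T ⌊ X? z ⌋ × T ⌊ ¬? (X? z) ⌋)
  side z with X? z
  ... | yes _ = inj₁ (_ , λ ())
  ... | no _ = inj₂ ((λ ()) , _)

exactly-one-edge : {G : Digraph} {A B : Fin (n G) → Set} {a b : Fin (n G)} →
  (A? : U.Decidable A) (B? : U.Decidable B) →
  A a → B b → Edge G a b → (∀ {p q} → A p → B q → Edge G p q → p ≡ a × q ≡ b) →
  ExactlyOneEdge G (λ z → ⌊ A? z ⌋) (λ z → ⌊ B? z ⌋)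
exactly-one-edge A? B? aa bb e unique =
  _ , _ , (fromWitness aa , fromWitness bb , e) ,
  λ p q ap bq → unique (toWitness {a? = A? p} ap) (toWitness {a? = B? q} bq)

module _ (G : Digraph) (strong : Strong G) (C : Cycle G) where
  private
    V : Set
    V = Fin (n G)

    del? : (a b : V) → Decidable (DelEdge G a b)
    del? a b x y = T? (adj G x y) ×-dec ¬? (x ≟ a ×-dec y ≟ b)

  Conclusion : Set
  Conclusion =
    (Σ V λ a → Σ V λ b → CycleEdge G C a b × StrongRel (DelEdge G a b))
    ⊎
    (Σ (V → Bool) λ A → Σ (V → Bool) λ B →
       IsPartition G A B × ExactlyOneEdge G A B × ExactlyOneEdge G B A)

  Out In : V → V → V → Set
  Out a b z = Reach (DelEdge G a b) a z
  In a b z = Reach (DelEdge G a b) z b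

  out? : (a b : V) → U.Decidable (Out a b)
  out? a b = reach? (del? a b) a

  in? : (a b : V) → U.Decidable (In a b)
  in? a b z = reach? (del? a b) z b

  reachSet : V → V → Subset (n G)
  reachSet a b = tabulate (λ z → ⌊ out? a b z ⌋)

  LargerReachSet : V → V → Set
  LargerReachSet u v = ∃₂ λ a b → CycleEdge G C a b × reachSet u v ⊂ reachSet a b

  deletable : CycleEdge G C a b → Reach (DelEdge G a b) a b → Conclusion
  deletable ab a⇝b = inj₁ (_ , _ , ab , strong-without strong a⇝b)

  module Undeletable {u v : V} (uv : CycleEdge G C u v) (v∉S : ¬ Out u v v) where
    S : V → Set
    S = Out u v

    -- Every vertex reaches u in G ∖ uv, so S is strongly connected there; and a walk starting
    -- in S stays in S, hence avoids every edge whose tail lies outside S.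
    within-S : ¬ S a → S z → S z′ → Reach (DelEdge G a b) z z′
    within-S ¬sa sz sz′ =
      mapReach (map₁ proj₁) (avoid-unreachable-tail ¬sa sz (prefix-to-tail (strong _ u) ◅◅ sz′))

    entering-S : ∃₂ λ x y → CycleEdge G C x y × ¬ S x × S y
    entering-S with other-separating-edge {C = C} (out? u v) uv (inj₁ (here , v∉S))
    ... | _ , _ , (e , _) , pq≢uv , inj₁ (sp , ¬sq) = contradiction (leaves-only-by sp ¬sq e) pq≢uv
    ... | p , q , pq , _ , inj₂ (¬sp , sq) = p , q , pq , ¬sp , sq

    module Reentry {x y : V} (xy : CycleEdge G C x y) (x∉S : ¬ S x) (y∈S : S y) where
      Q : V → Set
      Q = In x y

      S⊆Q : S z → Q z
      S⊆Q sz = within-S x∉S sz y∈S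

      partition : (∀ {z} → Q z → S z) → Conclusion
      partition Q⊆S = inj₂ (_ , _ , complement-partition {G = G} (out? u v) here v∉S
        , exactly-one-edge {G = G} (out? u v) (¬? ∘ out? u v) here v∉S (proj₁ uv) leaves-only-by
        , exactly-one-edge {G = G} (¬? ∘ out? u v) (out? u v) x∉S y∈S (proj₁ xy)
            λ ¬sp sq → enters-only-by (¬sp ∘ Q⊆S) (S⊆Q sq))

      module Escaping (x∉Q : ¬ Q x) {w : V} (w∈Q : Q w) (w∉S : ¬ S w) where
        -- A walk in G ∖ xy from y ∈ S to w ∉ S has to leave S, necessarily through uv.
        v∈Q : Q v
        v∈Q with avoid-or-suffix {a = u} {b = v} (suffix-from-head {a = x} (strong y w))
        ... | inj₁ y⇝w = contradiction (y∈S ◅◅ mapReach (map₁ proj₁) y⇝w) w∉S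
        ... | inj₂ v⇝w = mapReach proj₁ v⇝w ◅◅ w∈Q

        leaving-Q : ∃₂ λ a b → CycleEdge G C a b × Q a × ¬ Q b
        leaving-Q with other-separating-edge {C = C} (in? x y) xy (inj₂ (x∉Q , here))
        ... | a , b , ab , _ , inj₁ (qa , ¬qb) = a , b , ab , qa , ¬qb
        ... | _ , _ , (e , _) , ab≢xy , inj₂ (¬qa , qb) =
          contradiction (enters-only-by ¬qa qb e) ab≢xy

        exit-tail∉S : Edge G a b → ¬ Q b → ¬ S a
        exit-tail∉S {b = b} e ¬qb sa with out? u v b
        ... | yes sb = ¬qb (S⊆Q sb)
        ... | no ¬sb with leaves-only-by sa ¬sb e
        ...   | refl , refl = ¬qb v∈Q

        S⊆Out : Edge G a b → Q a → ¬ Q b → S z → Out a b z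
        S⊆Out e qa ¬qb sz =
          mapReach (map₁ proj₁) (avoid-nonreaching-head ¬qb qa)
          ◅◅ within-S (exit-tail∉S e ¬qb) y∈S sz

        larger : LargerReachSet u v
        larger =
          let (a , b , ab , qa , ¬qb) = leaving-Q
          in a , b , ab , ⊂-tabulate (out? u v) (out? a b) (S⊆Out (proj₁ ab) qa ¬qb) here
                            (exit-tail∉S (proj₁ ab) ¬qb)

      improve : Conclusion ⊎ LargerReachSet u v
      improve with in? x y x
      ... | yes x∈Q = inj₁ (deletable xy x∈Q)
      ... | no x∉Q with any? (λ w → in? x y w ×-dec ¬? (out? u v w))
      ...   | no Q⊆S =
        inj₁ (partition λ {z} qz → decidable-stable (out? u v z) λ ¬sz → Q⊆S (z , qz , ¬sz))
      ...   | yes (w , w∈Q , w∉S) = inj₂ (Escaping.larger x∉Q w∈Q w∉S)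

    improve : Conclusion ⊎ LargerReachSet u v
    improve = let (x , y , xy , x∉S , y∈S) = entering-S in Reentry.improve xy x∉S y∈S

  search : CycleEdge G C u v → Acc _⊃_ (reachSet u v) → Conclusion
  search {u = u} {v = v} uv (acc larger) with out? u v v
  ... | yes v∈S = deletable uv v∈S
  ... | no v∉S with Undeletable.improve uv v∉S
  ...   | inj₁ done = done
  ...   | inj₂ (_ , _ , ab , S⊂S′) = search ab (larger S⊂S′)

mainTheorem5 : (G : Digraph) → Strong G → (C : Cycle G) →
    (Σ (Fin (n G)) λ a → Σ (Fin (n G)) λ b →
       CycleEdge G C a b × StrongRel (DelEdge G a b))
    ⊎
    (Σ (Fin (n G) → Bool) λ A → Σ (Fin (n G) → Bool) λ B →
       IsPartition G A B × ExactlyOneEdge G A B × ExactlyOneEdge G B A)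
mainTheorem5 G strong C =
  let (_ , _ , uv , _) = consecutive-edge C zero
  in search G strong C uv (⊃-wellFounded _)
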